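{- Let $m\ge3$, $1\le a\le b<\frac m2$, $1\le c\le\frac m2$ be integers such that (i) $m$ is coprime to each of $\gcd(a-b,a+b+c)$, $\gcd(a-b,a+b-c)$, $\gcd(a+b,a-b+c)$, $\gcd(a+b,a-b-c)$; and (ii) if $v_2(m)>v_2(c)$, then neither $v_2(a)$ nor $v_2(b)$ equals $v_2(c)-1$. Let $p\ge 11$ be a prime with $p\mid m$. Then $\Phi_p(x)$ does not divide $P_{a,b,c}(x)=x^{2a+2b+c}+x^{2a+c}+x^{2b+c}+x^c-x^{a+b+2c}-x^{a+b}-2x^{a+b+c}$.
   Context: $\Phi_f(x)$ denotes the $f$-th cyclotomic polynomial. For a nonzero integer $x$, $v_2(x)$ is the exponent of $2$ in the prime factorization of $|x|$. -}

module Defs where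

open import Data.Nat as ℕ using (ℕ; zero; suc; NonZero)
open import Data.Nat.DivMod using (_%_; _/_)
open import Data.Integer as ℤ using (ℤ; +_)
open import Data.List using (List; []; _∷_; replicate)
open import Data.Product using (∃)
open import Relation.Binary.PropositionalEquality using (_≡_)

-- Integer polynomials as coefficient lists (lowest degree first).
Poly : Set
Poly = List ℤ

coeff : Poly → ℕ → ℤ
coeff []       _       = + 0
coeff (c ∷ _)  zero    = c
coeff (_ ∷ cs) (suc n) = coeff cs n

infixl 6 _+ₚ_
infixl 7 _*ₚ_ _·ₚ_

_+ₚ_ : Poly → Poly → Poly
[]       +ₚ q        = q
p        +ₚ []       = p
(a ∷ p)  +ₚ (b ∷ q)  = (a ℤ.+ b) ∷ (p +ₚ q)

_·ₚ_ : ℤ → Poly → Poly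
k ·ₚ []      = []
k ·ₚ (a ∷ p) = (k ℤ.* a) ∷ (k ·ₚ p)

_*ₚ_ : Poly → Poly → Poly
[]      *ₚ q = []
(a ∷ p) *ₚ q = (a ·ₚ q) +ₚ (+ 0 ∷ (p *ₚ q))

mono : ℤ → ℕ → Poly
mono k n = replicate n (+ 0) Data.List.++ (k ∷ [])

X^ : ℕ → Poly
X^ n = mono (+ 1) n

infix 4 _∣ₚ_
_∣ₚ_ : Poly → Poly → Set
F ∣ₚ G = ∃ λ (Q : Poly) → ∀ n → coeff (F *ₚ Q) n ≡ coeff G n

-- The p-th cyclotomic polynomial for p prime:
-- Φ_p(x) = (x^p - 1)/(x - 1) = 1 + x + ... + x^(p-1).
Φprime : ℕ → Poly
Φprime p = replicate p (+ 1)

Pabc : ℕ → ℕ → ℕ → Poly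
Pabc a b c =
  X^ (2 ℕ.* a ℕ.+ 2 ℕ.* b ℕ.+ c) +ₚ X^ (2 ℕ.* a ℕ.+ c) +ₚ X^ (2 ℕ.* b ℕ.+ c) +ₚ X^ c
  +ₚ mono (ℤ.- + 1) (a ℕ.+ b ℕ.+ 2 ℕ.* c) +ₚ mono (ℤ.- + 1) (a ℕ.+ b)
  +ₚ mono (ℤ.- + 2) (a ℕ.+ b ℕ.+ c)

-- 2-adic valuation of a natural number (fuel-based; correct for n > 0,
-- and the fuel n suffices since v₂(n) ≤ n).
v2-go : ℕ → ℕ → ℕ
v2-go zero    _       = 0
v2-go (suc f) zero    = 0
v2-go (suc f) (suc n) with suc n % 2
... | zero  = suc (v2-go f (suc n / 2))
... | suc _ = 0

v₂ : ℕ → ℕ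
v₂ n = v2-go n n

{-# OPTIONS --safe #-}
module Submission where

-- If Φ = 1 + x + ⋯ + x^(d-1) divides P, say P = Φ·Q, then in every residue class of exponents mod d the
-- coefficients of P add up to Q(1); summing over the d classes gives d·Q(1) = P(1) = 0, so every class sum
-- of P vanishes. The class of a+b+c carries the coefficient −2, so it contains one of the positive exponents
-- 2a+2b+c, 2a+c, 2b+c, c: hence d ∣ a+b or d ∣ a−b. If d ∣ a−b, the class of c has positive sum unless it
-- also contains a+b+2c or a+b, i.e. unless d ∣ a+b±c; if d ∣ a+b, the class of a+b has negative sum unless
-- it also contains 2a+c or 2b+c, i.e. unless d ∣ a−b±c. Either way d divides one of the four gcds.

open import Defs
open import Data.Nat using (ℕ; _≤_; _<_; _*_; _+_; suc)
open import Data.Nat.Divisibility using (_∣_)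
open import Data.Nat.Coprimality using (Coprime)
open import Data.Nat.GCD using (gcd)
open import Data.Nat.Primality using (Prime)
open import Data.Integer using (+_; ∣_∣) renaming (_+_ to _+ℤ_; _-_ to _-ℤ_)
open import Data.Product using (_×_)
open import Relation.Nullary using (¬_)
open import Relation.Binary.PropositionalEquality using (_≢_)

open import Data.Nat using (zero; pred; NonZero; nonTrivial⇒≢1)
open import Data.Nat.Properties using (+-suc; +-comm; +-identityʳ; suc-pred; ≤-reflexive; m+n≤o⇒m≤o)
open import Data.Nat.Divisibility using (_∣?_; _∣0; m∣m*n; >⇒∤)
open import Data.Nat.GCD using (gcd-greatest)
open import Data.Nat.Primality using (prime⇒nonZero; prime⇒nonTrivial)
open import Data.Integer using (ℤ; _⊖_) renaming (_*_ to _*ℤ_; -_ to -ℤ_)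
import Data.Integer.Properties as ℤ
open import Data.Integer.Divisibility.Signed
  using (∣ᵤ⇒∣; ∣⇒∣ᵤ; ∣-refl; ∣m⇒∣-m; ∣m∣n⇒∣m-n; ∣m+n∣m⇒∣n; ∣m+n∣n⇒∣m)
  renaming (_∣_ to _∣ℤ_; _∣?_ to _∣ℤ?_)
open import Data.Integer.Tactic.RingSolver using (solve-∀)
open import Algebra.Properties.CommutativeSemigroup ℤ.+-commutativeSemigroup using (interchange)
open import Algebra.Properties.AbelianGroup ℤ.+-0-abelianGroup using (∙-cancelˡ)
open import Data.List using (List; []; _∷_; foldl; replicate)
open import Data.Product using (_,_; uncurry)
open import Data.Sum using (_⊎_; inj₁; inj₂; [_,_]′) renaming (map to ⊎-map)
open import Data.Empty using (⊥; ⊥-elim)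
open import Function using (_∘_)
open import Relation.Nullary using (yes; no; contradiction)
open import Relation.Binary.PropositionalEquality
  using (_≡_; refl; sym; trans; cong; cong₂; subst; module ≡-Reasoning)

open ≡-Reasoning

sumFrom : ℕ → ℕ → (ℕ → ℤ) → ℤ
sumFrom r zero    f = + 0
sumFrom r (suc k) f = f r +ℤ sumFrom (suc r) k f

sumFrom-cong : ∀ r k {f g : ℕ → ℤ} → (∀ s → f s ≡ g s) → sumFrom r k f ≡ sumFrom r k g
sumFrom-cong r zero    f≗g = refl
sumFrom-cong r (suc k) f≗g = cong₂ _+ℤ_ (f≗g r) (sumFrom-cong (suc r) k f≗g)

sumFrom-+ : ∀ r k (f g : ℕ → ℤ) → sumFrom r k (λ s → f s +ℤ g s) ≡ sumFrom r k f +ℤ sumFrom r k g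
sumFrom-+ r zero    f g = refl
sumFrom-+ r (suc k) f g =
  trans (cong (f r +ℤ g r +ℤ_) (sumFrom-+ (suc r) k f g)) (interchange (f r) (g r) _ _)

sumFrom-*ʳ : ∀ r k (f : ℕ → ℤ) x → sumFrom r k (λ s → f s *ℤ x) ≡ sumFrom r k f *ℤ x
sumFrom-*ʳ r zero    f x = refl
sumFrom-*ʳ r (suc k) f x =
  trans (cong (f r *ℤ x +ℤ_) (sumFrom-*ʳ (suc r) k f x)) (sym (ℤ.*-distribʳ-+ x (f r) _))

sumFrom-const : ∀ r k x → sumFrom r k (λ _ → x) ≡ + k *ℤ x
sumFrom-const r zero    x = refl
sumFrom-const r (suc k) x = begin
  x +ℤ sumFrom (suc r) k (λ _ → x)  ≡⟨ cong (x +ℤ_) (sumFrom-const (suc r) k x) ⟩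
  x +ℤ + k *ℤ x                     ≡⟨ ℤ.suc-* (+ k) x ⟨
  + suc k *ℤ x                      ∎

sumFrom-suc : ∀ r k f → sumFrom r k (f ∘ suc) ≡ sumFrom (suc r) k f
sumFrom-suc r zero    f = refl
sumFrom-suc r (suc k) f = cong (f (suc r) +ℤ_) (sumFrom-suc (suc r) k f)

sumFrom-snoc : ∀ r k f → sumFrom r (suc k) f ≡ sumFrom r k f +ℤ f (r + k)
sumFrom-snoc r zero    f = begin
  f r +ℤ + 0        ≡⟨ ℤ.+-identityʳ (f r) ⟩
  f r               ≡⟨ cong f (+-identityʳ r) ⟨
  f (r + 0)         ≡⟨ ℤ.+-identityˡ _ ⟨
  + 0 +ℤ f (r + 0)  ∎
sumFrom-snoc r (suc k) f = begin
  f r +ℤ sumFrom (suc r) (suc k) f               ≡⟨ cong (f r +ℤ_) (sumFrom-snoc (suc r) k f) ⟩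
  f r +ℤ (sumFrom (suc r) k f +ℤ f (suc r + k))  ≡⟨ ℤ.+-assoc (f r) _ _ ⟨
  sumFrom r (suc k) f +ℤ f (suc r + k)           ≡⟨ cong (λ n → sumFrom r (suc k) f +ℤ f n) (+-suc r k) ⟨
  sumFrom r (suc k) f +ℤ f (r + suc k)           ∎

sumFrom-periodic : ∀ k f → (∀ s → f (s + k) ≡ f s) → ∀ r → sumFrom r k f ≡ sumFrom 0 k f
sumFrom-periodic k f f-periodic zero    = refl
sumFrom-periodic k f f-periodic (suc r) =
  trans (∙-cancelˡ (f r) _ _ slide) (sumFrom-periodic k f f-periodic r)
  where
  slide : f r +ℤ sumFrom (suc r) k f ≡ f r +ℤ sumFrom r k f
  slide = begin
    sumFrom r (suc k) f         ≡⟨ sumFrom-snoc r k f ⟩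
    sumFrom r k f +ℤ f (r + k)  ≡⟨ cong (sumFrom r k f +ℤ_) (f-periodic r) ⟩
    sumFrom r k f +ℤ f r        ≡⟨ ℤ.+-comm _ (f r) ⟩
    f r +ℤ sumFrom r k f        ∎

sumCoeffs : Poly → ℤ
sumCoeffs []      = + 0
sumCoeffs (g ∷ G) = g +ℤ sumCoeffs G

sumCoeffs-+ₚ : ∀ G H → sumCoeffs (G +ₚ H) ≡ sumCoeffs G +ℤ sumCoeffs H
sumCoeffs-+ₚ []      H       = sym (ℤ.+-identityˡ _)
sumCoeffs-+ₚ (g ∷ G) []      = sym (ℤ.+-identityʳ _)
sumCoeffs-+ₚ (g ∷ G) (h ∷ H) =
  trans (cong (g +ℤ h +ℤ_) (sumCoeffs-+ₚ G H)) (interchange g h _ _)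

sumCoeffs-mono : ∀ k e → sumCoeffs (mono k e) ≡ k
sumCoeffs-mono k zero    = ℤ.+-identityʳ k
sumCoeffs-mono k (suc e) = trans (ℤ.+-identityˡ _) (sumCoeffs-mono k e)

addTerm : Poly → ℤ × ℕ → Poly
addTerm G (k , e) = G +ₚ mono k e

additive-foldl : (L : Poly → ℤ) (μ : ℤ → ℕ → ℤ)
  → (∀ G H → L (G +ₚ H) ≡ L G +ℤ L H) → (∀ k e → L (mono k e) ≡ μ k e)
  → ∀ G ts → L (foldl addTerm G ts) ≡ foldl (λ s t → s +ℤ uncurry μ t) (L G) ts
additive-foldl L μ L-+ₚ L-mono G []             = refl
additive-foldl L μ L-+ₚ L-mono G ((k , e) ∷ ts) =
  trans (additive-foldl L μ L-+ₚ L-mono (addTerm G (k , e)) ts)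
        (cong (λ s → foldl (λ s t → s +ℤ uncurry μ t) s ts)
              (trans (L-+ₚ G (mono k e)) (cong (L G +ℤ_) (L-mono k e))))

Bit : ℤ → Set
Bit x = x ≡ + 0 ⊎ x ≡ + 1

pattern is0 = inj₁ refl
pattern is1 = inj₂ refl

[r+e]-[r+e′]≡e-e′ : ∀ r e e′ → + (r + e) -ℤ + (r + e′) ≡ + e -ℤ + e′
[r+e]-[r+e′]≡e-e′ r e e′ = begin
  + (r + e) -ℤ + (r + e′)  ≡⟨ ℤ.[+m]-[+n]≡m⊖n (r + e) (r + e′) ⟩
  (r + e) ⊖ (r + e′)       ≡⟨ ℤ.+-cancelˡ-⊖ r e e′ ⟩
  e ⊖ e′                   ≡⟨ ℤ.[+m]-[+n]≡m⊖n e e′ ⟨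
  + e -ℤ + e′              ∎

∣ℤ-neg : ∀ {k x} → k ∣ℤ -ℤ x → k ∣ℤ x
∣ℤ-neg {x = x} k∣-x = subst (_ ∣ℤ_) (ℤ.neg-involutive x) (∣m⇒∣-m k∣-x)

module ResidueClassSums (d : ℕ) .{{_ : NonZero d}} where

  ∣⇒∣ℤ : ∀ {n} → d ∣ n → + d ∣ℤ + n
  ∣⇒∣ℤ = ∣ᵤ⇒∣

  ∣ℤ⇒∣ : ∀ {n} → + d ∣ℤ + n → d ∣ n
  ∣ℤ⇒∣ = ∣⇒∣ᵤ

  d∣-resp : ∀ {x y} → x ≡ y → + d ∣ℤ x → + d ∣ℤ y
  d∣-resp = subst (+ d ∣ℤ_)

  χ : ℕ → ℤ
  χ n with d ∣? n
  ... | yes _ = + 1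
  ... | no  _ = + 0

  χ-bit : ∀ n → Bit (χ n)
  χ-bit n with d ∣? n
  ... | yes _ = is1
  ... | no  _ = is0

  χ-yes : ∀ {n} → d ∣ n → χ n ≡ + 1
  χ-yes {n} d∣n with d ∣? n
  ... | yes _   = refl
  ... | no  d∤n = contradiction d∣n d∤n

  χ-no : ∀ {n} → ¬ d ∣ n → χ n ≡ + 0
  χ-no {n} d∤n with d ∣? n
  ... | yes d∣n = contradiction d∣n d∤n
  ... | no  _   = refl

  χ≡1⇒∣ : ∀ {n} → χ n ≡ + 1 → d ∣ n
  χ≡1⇒∣ {n} χ≡1 with d ∣? n
  χ≡1⇒∣ {n} refl | yes d∣n = d∣n
  χ≡1⇒∣ {n} ()   | no  _

  χ-cong : ∀ {n n′} → + d ∣ℤ + n -ℤ + n′ → χ n ≡ χ n′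
  χ-cong {n} {n′} d∣n-n′ with d ∣? n | d ∣? n′
  ... | yes _   | yes _    = refl
  ... | no  _   | no  _    = refl
  ... | yes d∣n | no  d∤n′ =
    contradiction (∣ℤ⇒∣ (∣ℤ-neg (∣m+n∣m⇒∣n d∣n-n′ (∣⇒∣ℤ d∣n)))) d∤n′
  ... | no  d∤n | yes d∣n′ =
    contradiction (∣ℤ⇒∣ (∣m+n∣n⇒∣m d∣n-n′ (∣m⇒∣-m (∣⇒∣ℤ d∣n′)))) d∤n

  χ-shift-cong : ∀ r {e e′} → + d ∣ℤ + e -ℤ + e′ → χ (r + e) ≡ χ (r + e′)
  χ-shift-cong r {e} {e′} = χ-cong ∘ d∣-resp (sym ([r+e]-[r+e′]≡e-e′ r e e′))

  χ-periodic : ∀ n → χ (n + d) ≡ χ n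
  χ-periodic n = χ-cong (d∣-resp (sym (cancel (+ n) (+ d))) ∣-refl)
    where
    cancel : ∀ n d → n +ℤ d -ℤ n ≡ d
    cancel = solve-∀

  sumFrom-χ-zero : ∀ r k → suc r + k ≤ d → sumFrom (suc r) k χ ≡ + 0
  sumFrom-χ-zero r zero    _     = refl
  sumFrom-χ-zero r (suc k) bound =
    cong₂ _+ℤ_ (χ-no (>⇒∤ (m+n≤o⇒m≤o (suc (suc r)) bound′))) (sumFrom-χ-zero (suc r) k bound′)
    where
    bound′ : suc (suc r) + k ≤ d
    bound′ = subst (_≤ d) (+-suc (suc r) k) bound

  sumFrom-χ : sumFrom 0 d χ ≡ + 1
  sumFrom-χ = begin
    sumFrom 0 d χ                ≡⟨ cong (λ k → sumFrom 0 k χ) (sym (suc-pred d)) ⟩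
    χ 0 +ℤ sumFrom 1 (pred d) χ  ≡⟨ cong₂ _+ℤ_ (χ-yes (d ∣0)) (sumFrom-χ-zero 0 (pred d) 1+pred[d]≤d) ⟩
    + 1                          ∎
    where
    1+pred[d]≤d : 1 + pred d ≤ d
    1+pred[d]≤d = ≤-reflexive (suc-pred d)

  -- classSum r G sums the coefficients of xⁿ in G over the exponents n with d ∣ r + n.
  classSum : ℕ → Poly → ℤ
  classSum r []      = + 0
  classSum r (g ∷ G) = χ r *ℤ g +ℤ classSum (suc r) G

  classSum-0∷ : ∀ r G → classSum r (+ 0 ∷ G) ≡ classSum (suc r) G
  classSum-0∷ r G = trans (cong (_+ℤ classSum (suc r) G) (ℤ.*-zeroʳ (χ r))) (ℤ.+-identityˡ _)

  classSum-zero : ∀ G → (∀ n → coeff G n ≡ + 0) → ∀ r → classSum r G ≡ + 0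
  classSum-zero []      G≗0 r = refl
  classSum-zero (g ∷ G) G≗0 r rewrite G≗0 0 =
    trans (classSum-0∷ r G) (classSum-zero G (G≗0 ∘ suc) (suc r))

  classSum-cong : ∀ G H → (∀ n → coeff G n ≡ coeff H n) → ∀ r → classSum r G ≡ classSum r H
  classSum-cong []      H       G≗H r = sym (classSum-zero H (λ n → sym (G≗H n)) r)
  classSum-cong (g ∷ G) []      G≗H r = classSum-zero (g ∷ G) G≗H r
  classSum-cong (g ∷ G) (h ∷ H) G≗H r =
    cong₂ (λ x y → χ r *ℤ x +ℤ y) (G≗H 0) (classSum-cong G H (G≗H ∘ suc) (suc r))

  classSum-+ₚ : ∀ r G H → classSum r (G +ₚ H) ≡ classSum r G +ℤ classSum r H
  classSum-+ₚ r []      H       = sym (ℤ.+-identityˡ _)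
  classSum-+ₚ r (g ∷ G) []      = sym (ℤ.+-identityʳ _)
  classSum-+ₚ r (g ∷ G) (h ∷ H) = begin
    χ r *ℤ (g +ℤ h) +ℤ classSum (suc r) (G +ₚ H)
      ≡⟨ cong₂ _+ℤ_ (ℤ.*-distribˡ-+ (χ r) g h) (classSum-+ₚ (suc r) G H) ⟩
    (χ r *ℤ g +ℤ χ r *ℤ h) +ℤ (classSum (suc r) G +ℤ classSum (suc r) H)
      ≡⟨ interchange (χ r *ℤ g) _ _ _ ⟩
    (χ r *ℤ g +ℤ classSum (suc r) G) +ℤ (χ r *ℤ h +ℤ classSum (suc r) H)
      ∎

  classSum-·ₚ : ∀ r k G → classSum r (k ·ₚ G) ≡ k *ℤ classSum r G
  classSum-·ₚ r k []      = sym (ℤ.*-zeroʳ k)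
  classSum-·ₚ r k (g ∷ G) =
    trans (cong (χ r *ℤ (k *ℤ g) +ℤ_) (classSum-·ₚ (suc r) k G)) (factor (χ r) k g _)
    where
    factor : ∀ x k g y → x *ℤ (k *ℤ g) +ℤ k *ℤ y ≡ k *ℤ (x *ℤ g +ℤ y)
    factor = solve-∀

  classSum-mono : ∀ r k e → classSum r (mono k e) ≡ χ (r + e) *ℤ k
  classSum-mono r k zero    = trans (ℤ.+-identityʳ _) (cong (λ n → χ n *ℤ k) (sym (+-identityʳ r)))
  classSum-mono r k (suc e) = begin
    classSum r (+ 0 ∷ mono k e)  ≡⟨ classSum-0∷ r (mono k e) ⟩
    classSum (suc r) (mono k e)  ≡⟨ classSum-mono (suc r) k e ⟩
    χ (suc r + e) *ℤ k           ≡⟨ cong (λ n → χ n *ℤ k) (sym (+-suc r e)) ⟩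
    χ (r + suc e) *ℤ k           ∎

  classSum-periodic : ∀ r G → classSum (r + d) G ≡ classSum r G
  classSum-periodic r []      = refl
  classSum-periodic r (g ∷ G) =
    cong₂ (λ x y → x *ℤ g +ℤ y) (χ-periodic r) (classSum-periodic (suc r) G)

  classSum-replicate*ₚ : ∀ k Q r
    → classSum r (replicate k (+ 1) *ₚ Q) ≡ sumFrom r k (λ s → classSum s Q)
  classSum-replicate*ₚ zero    Q r = refl
  classSum-replicate*ₚ (suc k) Q r = begin
    classSum r ((+ 1 ·ₚ Q) +ₚ (+ 0 ∷ replicate k (+ 1) *ₚ Q))
      ≡⟨ classSum-+ₚ r (+ 1 ·ₚ Q) _ ⟩
    classSum r (+ 1 ·ₚ Q) +ℤ classSum r (+ 0 ∷ replicate k (+ 1) *ₚ Q)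
      ≡⟨ cong₂ _+ℤ_ (trans (classSum-·ₚ r (+ 1) Q) (ℤ.*-identityˡ _))
                    (trans (classSum-0∷ r (replicate k (+ 1) *ₚ Q)) (classSum-replicate*ₚ k Q (suc r))) ⟩
    classSum r Q +ℤ sumFrom (suc r) k (λ s → classSum s Q)
      ∎

  sumFrom-classSum : ∀ G → sumFrom 0 d (λ r → classSum r G) ≡ sumCoeffs G
  sumFrom-classSum []      = trans (sumFrom-const 0 d (+ 0)) (ℤ.*-zeroʳ (+ d))
  sumFrom-classSum (g ∷ G) = begin
    sumFrom 0 d (λ r → χ r *ℤ g +ℤ classSum (suc r) G)
      ≡⟨ sumFrom-+ 0 d _ _ ⟩
    sumFrom 0 d (λ r → χ r *ℤ g) +ℤ sumFrom 0 d (λ r → classSum (suc r) G)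
      ≡⟨ cong₂ _+ℤ_ (sumFrom-*ʳ 0 d χ g) (sumFrom-suc 0 d _) ⟩
    sumFrom 0 d χ *ℤ g +ℤ sumFrom 1 d (λ r → classSum r G)
      ≡⟨ cong₂ _+ℤ_ (cong (_*ℤ g) sumFrom-χ)
                    (sumFrom-periodic d _ (λ r → classSum-periodic r G) 1) ⟩
    + 1 *ℤ g +ℤ sumFrom 0 d (λ r → classSum r G)
      ≡⟨ cong₂ _+ℤ_ (ℤ.*-identityˡ g) (sumFrom-classSum G) ⟩
    g +ℤ sumCoeffs G
      ∎

  classSum-Φ-multiple : ∀ G Q → (∀ n → coeff (Φprime d *ₚ Q) n ≡ coeff G n)
    → ∀ r → classSum r G ≡ sumCoeffs Q
  classSum-Φ-multiple G Q ΦQ≗G r = begin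
    classSum r G                       ≡⟨ classSum-cong (Φprime d *ₚ Q) G ΦQ≗G r ⟨
    classSum r (Φprime d *ₚ Q)         ≡⟨ classSum-replicate*ₚ d Q r ⟩
    sumFrom r d (λ s → classSum s Q)   ≡⟨ sumFrom-periodic d _ (λ s → classSum-periodic s Q) r ⟩
    sumFrom 0 d (λ s → classSum s Q)   ≡⟨ sumFrom-classSum Q ⟩
    sumCoeffs Q                        ∎

  Φ∣⇒classSum≡0 : ∀ G → sumCoeffs G ≡ + 0 → Φprime d ∣ₚ G → ∀ r → classSum r G ≡ + 0
  Φ∣⇒classSum≡0 G G[1]≡0 (Q , ΦQ≗G) r = trans (classSum-Φ-multiple G Q ΦQ≗G r) Q[1]≡0
    where
    d*Q[1]≡0 : + d *ℤ sumCoeffs Q ≡ + d *ℤ + 0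
    d*Q[1]≡0 = begin
      + d *ℤ sumCoeffs Q                ≡⟨ sumFrom-const 0 d _ ⟨
      sumFrom 0 d (λ _ → sumCoeffs Q)   ≡⟨ sumFrom-cong 0 d (sym ∘ classSum-Φ-multiple G Q ΦQ≗G) ⟩
      sumFrom 0 d (λ s → classSum s G)  ≡⟨ sumFrom-classSum G ⟩
      sumCoeffs G                       ≡⟨ G[1]≡0 ⟩
      + 0                               ≡⟨ ℤ.*-zeroʳ (+ d) ⟨
      + d *ℤ + 0                        ∎
    Q[1]≡0 : sumCoeffs Q ≡ + 0
    Q[1]≡0 = ℤ.*-cancelˡ-≡ (+ d) _ _ d*Q[1]≡0

  -- classOf e ≡ −e (mod d), so classSum (classOf e) sums the coefficients at the exponents ≡ e (mod d).
  classOf : ℕ → ℕ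
  classOf e = pred d * e

  d∣classOf+ : ∀ e → d ∣ classOf e + e
  d∣classOf+ e = subst (d ∣_) (sym classOf+≡) (m∣m*n e)
    where
    classOf+≡ : classOf e + e ≡ d * e
    classOf+≡ = trans (+-comm (pred d * e) e) (cong (_* e) (suc-pred d))

  χ-classOf-self : ∀ e → χ (classOf e + e) ≡ + 1
  χ-classOf-self e = χ-yes (d∣classOf+ e)

  χ-classOf≡1⇒∣ : ∀ e₀ e → χ (classOf e₀ + e) ≡ + 1 → + d ∣ℤ + e -ℤ + e₀
  χ-classOf≡1⇒∣ e₀ e χ≡1 =
    d∣-resp ([r+e]-[r+e′]≡e-e′ (classOf e₀) e e₀)
          (∣m∣n⇒∣m-n (∣⇒∣ℤ (χ≡1⇒∣ χ≡1)) (∣⇒∣ℤ (d∣classOf+ e₀)))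

  χ-classOf≡0 : ∀ e₀ e → ¬ (+ d ∣ℤ + e -ℤ + e₀) → χ (classOf e₀ + e) ≡ + 0
  χ-classOf≡0 e₀ e d∤e-e₀ with χ-bit (classOf e₀ + e)
  ... | inj₁ χ≡0 = χ≡0
  ... | inj₂ χ≡1 = contradiction (χ-classOf≡1⇒∣ e₀ e χ≡1) d∤e-e₀

signedCount : ℤ → ℤ → ℤ → ℤ → ℤ → ℤ → ℤ → ℤ
signedCount i₁ i₂ i₃ i₄ i₅ i₆ i₇ = i₁ +ℤ i₂ +ℤ i₃ +ℤ i₄ -ℤ i₅ -ℤ i₆ -ℤ + 2 *ℤ i₇

signedCount≡0⇒positive-term : ∀ {i₁ i₂ i₃ i₄ i₅ i₆ i₇}
  → Bit i₁ → Bit i₂ → Bit i₃ → Bit i₄ → Bit i₅ → Bit i₆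
  → i₇ ≡ + 1 → signedCount i₁ i₂ i₃ i₄ i₅ i₆ i₇ ≡ + 0
  → i₁ ≡ + 1 ⊎ i₂ ≡ + 1 ⊎ i₃ ≡ + 1 ⊎ i₄ ≡ + 1
signedCount≡0⇒positive-term (inj₂ i₁≡1) _ _ _ _ _ _ _ = inj₁ i₁≡1
signedCount≡0⇒positive-term _ (inj₂ i₂≡1) _ _ _ _ _ _ = inj₂ (inj₁ i₂≡1)
signedCount≡0⇒positive-term _ _ (inj₂ i₃≡1) _ _ _ _ _ = inj₂ (inj₂ (inj₁ i₃≡1))
signedCount≡0⇒positive-term _ _ _ (inj₂ i₄≡1) _ _ _ _ = inj₂ (inj₂ (inj₂ i₄≡1))
signedCount≡0⇒positive-term is0 is0 is0 is0 is0 is0 refl ()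
signedCount≡0⇒positive-term is0 is0 is0 is0 is0 is1 refl ()
signedCount≡0⇒positive-term is0 is0 is0 is0 is1 is0 refl ()
signedCount≡0⇒positive-term is0 is0 is0 is0 is1 is1 refl ()

signedCount≢0-positive : ∀ {i₁ i₂ i₃ i₄ i₅ i₆ i₇} → Bit i₁ → Bit i₇
  → i₂ ≡ i₇ → i₃ ≡ i₇ → i₄ ≡ + 1 → i₅ ≡ + 0 → i₆ ≡ + 0 → signedCount i₁ i₂ i₃ i₄ i₅ i₆ i₇ ≢ + 0
signedCount≢0-positive is0 is0 refl refl refl refl refl ()
signedCount≢0-positive is0 is1 refl refl refl refl refl ()
signedCount≢0-positive is1 is0 refl refl refl refl refl ()
signedCount≢0-positive is1 is1 refl refl refl refl refl ()

signedCount≢0-negative : ∀ {i₁ i₂ i₃ i₄ i₅ i₆ i₇} → Bit i₅ → Bit i₇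
  → i₁ ≡ i₇ → i₄ ≡ i₇ → i₂ ≡ + 0 → i₃ ≡ + 0 → i₆ ≡ + 1 → signedCount i₁ i₂ i₃ i₄ i₅ i₆ i₇ ≢ + 0
signedCount≢0-negative is0 is0 refl refl refl refl refl ()
signedCount≢0-negative is0 is1 refl refl refl refl refl ()
signedCount≢0-negative is1 is0 refl refl refl refl refl ()
signedCount≢0-negative is1 is1 refl refl refl refl refl ()

module ClassSumsOfPabc (d : ℕ) .{{_ : NonZero d}} (a b c : ℕ) where
  open ResidueClassSums d

  e₁ e₂ e₃ e₄ e₅ e₆ e₇ : ℕ
  e₁ = 2 * a + 2 * b + c
  e₂ = 2 * a + c
  e₃ = 2 * b + c
  e₄ = c
  e₅ = a + b + 2 * c
  e₆ = a + b
  e₇ = a + b + c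

  Pabc-terms : List (ℤ × ℕ)
  Pabc-terms = (+ 1 , e₁) ∷ (+ 1 , e₂) ∷ (+ 1 , e₃) ∷ (+ 1 , e₄)
             ∷ (-ℤ + 1 , e₅) ∷ (-ℤ + 1 , e₆) ∷ (-ℤ + 2 , e₇) ∷ []

  -- Pabc a b c is definitionally foldl addTerm [] Pabc-terms.
  sumCoeffs-Pabc : sumCoeffs (Pabc a b c) ≡ + 0
  sumCoeffs-Pabc = additive-foldl sumCoeffs (λ k _ → k) sumCoeffs-+ₚ sumCoeffs-mono [] Pabc-terms

  classSum-Pabc : ∀ r → classSum r (Pabc a b c)
    ≡ signedCount (χ (r + e₁)) (χ (r + e₂)) (χ (r + e₃)) (χ (r + e₄))
                  (χ (r + e₅)) (χ (r + e₆)) (χ (r + e₇))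
  classSum-Pabc r =
    trans (additive-foldl (classSum r) (λ k e → χ (r + e) *ℤ k) (classSum-+ₚ r) (classSum-mono r)
                          [] Pabc-terms)
          (expand (χ (r + e₁)) (χ (r + e₂)) (χ (r + e₃)) (χ (r + e₄))
                  (χ (r + e₅)) (χ (r + e₆)) (χ (r + e₇)))
    where
    expand : ∀ i₁ i₂ i₃ i₄ i₅ i₆ i₇
      → + 0 +ℤ i₁ *ℤ + 1 +ℤ i₂ *ℤ + 1 +ℤ i₃ *ℤ + 1 +ℤ i₄ *ℤ + 1
          +ℤ i₅ *ℤ (-ℤ + 1) +ℤ i₆ *ℤ (-ℤ + 1) +ℤ i₇ *ℤ (-ℤ + 2)
        ≡ i₁ +ℤ i₂ +ℤ i₃ +ℤ i₄ -ℤ i₅ -ℤ i₆ -ℤ + 2 *ℤ i₇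
    expand = solve-∀

  A B C : ℤ
  A = + a
  B = + b
  C = + c

  -- The solver sees + (2 * n) in its definitional unfolding + n +ℤ (+ n +ℤ + 0).
  e₁-e₇ : + e₁ -ℤ + e₇ ≡ A +ℤ B
  e₁-e₇ = ring A B C
    where
    ring : ∀ A B C → A +ℤ (A +ℤ + 0) +ℤ (B +ℤ (B +ℤ + 0)) +ℤ C -ℤ (A +ℤ B +ℤ C) ≡ A +ℤ B
    ring = solve-∀

  e₂-e₇ : + e₂ -ℤ + e₇ ≡ A -ℤ B
  e₂-e₇ = ring A B C
    where
    ring : ∀ A B C → A +ℤ (A +ℤ + 0) +ℤ C -ℤ (A +ℤ B +ℤ C) ≡ A -ℤ B
    ring = solve-∀

  e₃-e₇ : + e₃ -ℤ + e₇ ≡ -ℤ (A -ℤ B)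
  e₃-e₇ = ring A B C
    where
    ring : ∀ A B C → B +ℤ (B +ℤ + 0) +ℤ C -ℤ (A +ℤ B +ℤ C) ≡ -ℤ (A -ℤ B)
    ring = solve-∀

  e₄-e₇ : + e₄ -ℤ + e₇ ≡ -ℤ (A +ℤ B)
  e₄-e₇ = ring A B C
    where
    ring : ∀ A B C → C -ℤ (A +ℤ B +ℤ C) ≡ -ℤ (A +ℤ B)
    ring = solve-∀

  e₅-e₄ : + e₅ -ℤ + e₄ ≡ A +ℤ B +ℤ C
  e₅-e₄ = ring A B C
    where
    ring : ∀ A B C → A +ℤ B +ℤ (C +ℤ (C +ℤ + 0)) -ℤ C ≡ A +ℤ B +ℤ C
    ring = solve-∀

  e₆-e₄ : + e₆ -ℤ + e₄ ≡ A +ℤ B -ℤ C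
  e₆-e₄ = refl

  e₂-e₆ : + e₂ -ℤ + e₆ ≡ A -ℤ B +ℤ C
  e₂-e₆ = ring A B C
    where
    ring : ∀ A B C → A +ℤ (A +ℤ + 0) +ℤ C -ℤ (A +ℤ B) ≡ A -ℤ B +ℤ C
    ring = solve-∀

  e₃-e₆ : + e₃ -ℤ + e₆ ≡ -ℤ (A -ℤ B -ℤ C)
  e₃-e₆ = ring A B C
    where
    ring : ∀ A B C → B +ℤ (B +ℤ + 0) +ℤ C -ℤ (A +ℤ B) ≡ -ℤ (A -ℤ B -ℤ C)
    ring = solve-∀

  module _ (vanish : ∀ r → classSum r (Pabc a b c) ≡ + 0) where

    signedCount-at : ∀ e₀
      → signedCount (χ (classOf e₀ + e₁)) (χ (classOf e₀ + e₂)) (χ (classOf e₀ + e₃)) (χ (classOf e₀ + e₄))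
                    (χ (classOf e₀ + e₅)) (χ (classOf e₀ + e₆)) (χ (classOf e₀ + e₇))
        ≡ + 0
    signedCount-at e₀ = trans (sym (classSum-Pabc (classOf e₀))) (vanish (classOf e₀))

    d∣a+b⊎d∣a-b : + d ∣ℤ A +ℤ B ⊎ + d ∣ℤ A -ℤ B
    d∣a+b⊎d∣a-b
      with signedCount≡0⇒positive-term (χ-bit _) (χ-bit _) (χ-bit _) (χ-bit _) (χ-bit _) (χ-bit _)
                                       (χ-classOf-self e₇) (signedCount-at e₇)
    ... | inj₁ χ₁≡1               = inj₁ (d∣-resp e₁-e₇ (χ-classOf≡1⇒∣ e₇ e₁ χ₁≡1))
    ... | inj₂ (inj₁ χ₂≡1)        = inj₂ (d∣-resp e₂-e₇ (χ-classOf≡1⇒∣ e₇ e₂ χ₂≡1))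
    ... | inj₂ (inj₂ (inj₁ χ₃≡1)) = inj₂ (∣ℤ-neg (d∣-resp e₃-e₇ (χ-classOf≡1⇒∣ e₇ e₃ χ₃≡1)))
    ... | inj₂ (inj₂ (inj₂ χ₄≡1)) = inj₁ (∣ℤ-neg (d∣-resp e₄-e₇ (χ-classOf≡1⇒∣ e₇ e₄ χ₄≡1)))

    d∣a-b⇒d∣a+b±c : + d ∣ℤ A -ℤ B → + d ∣ℤ A +ℤ B +ℤ C ⊎ + d ∣ℤ A +ℤ B -ℤ C
    d∣a-b⇒d∣a+b±c d∣A-B with + d ∣ℤ? A +ℤ B +ℤ C | + d ∣ℤ? A +ℤ B -ℤ C
    ... | yes d∣A+B+C | _           = inj₁ d∣A+B+C
    ... | no  _       | yes d∣A+B-C = inj₂ d∣A+B-C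
    ... | no  d∤A+B+C | no  d∤A+B-C = ⊥-elim (signedCount≢0-positive (χ-bit _) (χ-bit _)
      (χ-shift-cong (classOf e₄) (d∣-resp (sym e₂-e₇) d∣A-B))
      (χ-shift-cong (classOf e₄) (d∣-resp (sym e₃-e₇) (∣m⇒∣-m d∣A-B)))
      (χ-classOf-self e₄)
      (χ-classOf≡0 e₄ e₅ (d∤A+B+C ∘ d∣-resp e₅-e₄))
      (χ-classOf≡0 e₄ e₆ (d∤A+B-C ∘ d∣-resp e₆-e₄))
      (signedCount-at e₄))

    d∣a+b⇒d∣a-b±c : + d ∣ℤ A +ℤ B → + d ∣ℤ A -ℤ B +ℤ C ⊎ + d ∣ℤ A -ℤ B -ℤ C
    d∣a+b⇒d∣a-b±c d∣A+B with + d ∣ℤ? A -ℤ B +ℤ C | + d ∣ℤ? A -ℤ B -ℤ C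
    ... | yes d∣A-B+C | _           = inj₁ d∣A-B+C
    ... | no  _       | yes d∣A-B-C = inj₂ d∣A-B-C
    ... | no  d∤A-B+C | no  d∤A-B-C = ⊥-elim (signedCount≢0-negative (χ-bit _) (χ-bit _)
      (χ-shift-cong (classOf e₆) (d∣-resp (sym e₁-e₇) d∣A+B))
      (χ-shift-cong (classOf e₆) (d∣-resp (sym e₄-e₇) (∣m⇒∣-m d∣A+B)))
      (χ-classOf≡0 e₆ e₂ (d∤A-B+C ∘ d∣-resp e₂-e₆))
      (χ-classOf≡0 e₆ e₃ (d∤A-B-C ∘ ∣ℤ-neg ∘ d∣-resp e₃-e₆))
      (χ-classOf-self e₆)
      (signedCount-at e₆))

  Φ∣Pabc⇒common-divisor : Φprime d ∣ₚ Pabc a b c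
    → (+ d ∣ℤ A -ℤ B × + d ∣ℤ A +ℤ B +ℤ C) ⊎ (+ d ∣ℤ A -ℤ B × + d ∣ℤ A +ℤ B -ℤ C)
    ⊎ (+ d ∣ℤ A +ℤ B × + d ∣ℤ A -ℤ B +ℤ C) ⊎ (+ d ∣ℤ A +ℤ B × + d ∣ℤ A -ℤ B -ℤ C)
  Φ∣Pabc⇒common-divisor Φ∣P =
    [ (λ d∣A+B → inj₂ (inj₂ (⊎-map (d∣A+B ,_) (d∣A+B ,_) (d∣a+b⇒d∣a-b±c vanish d∣A+B))))
    , (λ d∣A-B → ⊎-map (d∣A-B ,_) (inj₁ ∘ (d∣A-B ,_)) (d∣a-b⇒d∣a+b±c vanish d∣A-B))
    ]′ (d∣a+b⊎d∣a-b vanish)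
    where
    vanish : ∀ r → classSum r (Pabc a b c) ≡ + 0
    vanish = Φ∣⇒classSum≡0 (Pabc a b c) sumCoeffs-Pabc Φ∣P

lemma4p7 : (m a b c p : ℕ) → 3 ≤ m → 1 ≤ a → a ≤ b → 2 * b < m → 1 ≤ c → 2 * c ≤ m
    → Coprime m (gcd ∣ + a -ℤ + b ∣ ∣ + a +ℤ + b +ℤ + c ∣)
    → Coprime m (gcd ∣ + a -ℤ + b ∣ ∣ + a +ℤ + b -ℤ + c ∣)
    → Coprime m (gcd ∣ + a +ℤ + b ∣ ∣ + a -ℤ + b +ℤ + c ∣)
    → Coprime m (gcd ∣ + a +ℤ + b ∣ ∣ + a -ℤ + b -ℤ + c ∣)
    → (v₂ c < v₂ m → (suc (v₂ a) ≢ v₂ c) × (suc (v₂ b) ≢ v₂ c))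
    → Prime p → 11 ≤ p → p ∣ m
    → ¬ (Φprime p ∣ₚ Pabc a b c)
lemma4p7 m a b c p _ _ _ _ _ _ m⊥₁ m⊥₂ m⊥₃ m⊥₄ _ p-prime _ p∣m Φp∣P =
  [ excluded m⊥₁ , [ excluded m⊥₂ , [ excluded m⊥₃ , excluded m⊥₄ ]′ ]′ ]′
    (ClassSumsOfPabc.Φ∣Pabc⇒common-divisor p {{prime⇒nonZero p-prime}} a b c Φp∣P)
  where
  excluded : ∀ {x y} → Coprime m (gcd ∣ x ∣ ∣ y ∣) → + p ∣ℤ x × + p ∣ℤ y → ⊥
  excluded m⊥gcd (p∣x , p∣y) = nonTrivial⇒≢1 {{prime⇒nonTrivial p-prime}}
    (m⊥gcd (p∣m , gcd-greatest (∣⇒∣ᵤ p∣x) (∣⇒∣ᵤ p∣y)))
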